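{- Let $A=(Ctrl,Sto,\mathit{init},\mathit{fin},\to)$ and $A'=(Ctrl',Sto',\mathit{init}',\mathit{fin}',\to')$ be automata, $L,R,J$ live alignment conditions, and $\mathcal{Q},\mathcal{S}\subseteq Sto\times Sto'$. Suppose $\prod(A,A',L,R,J)$ is $\mathcal{Q}$-adequate and $an$ is an annotation of $\prod(A,A',L,R,J)$ for $\{\mathcal{Q}\}\{\mathcal{S}\}$. If $an$ is valid then $A,A'\models\langle\mathcal{Q}\Rightarrow\mathcal{S}\rangle$.
   Context: An automaton is a tuple $(Ctrl,Sto,\mathit{init},\mathit{fin},\to)$ where $Sto$ is a set, $Ctrl$ a finite set containing distinct $\mathit{init},\mathit{fin}$, and $\to\ \subseteq(Ctrl\times Sto)\times(Ctrl\times Sto)$ with $(n,s)\to(m,t)$ implying $n\neq\mathit{fin}$ and $n\neq m$. Given an automaton $B=(Ctrl_B,Sto_B,\mathit{init}_B,\mathit{fin}_B,\to_B)$ and $P,Q\subseteq Sto_B$, an annotation of $B$ for $\{P\}\{Q\}$ is a function $an$ from $Ctrl_B$ to subsets of $Sto_B$ with $an(\mathit{init}_B)=P$ and $an(\mathit{fin}_B)=Q$; it is valid if for all control points $n,m$, all $s\in an(n)$ and all $t$ with $(n,s)\to_B(m,t)$, we have $t\in an(m)$. For automata $A,A'$ and $\mathcal{R},\mathcal{S}\subseteq Sto\times Sto'$, $A,A'\models\langle\mathcal{R}\Rightarrow\mathcal{S}\rangle$ means: for all $s,s',t,t'$ with $(\mathit{init},s)\to^*(\mathit{fin},t)$ and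 $(\mathit{init}',s')\to'^*(\mathit{fin}',t')$, if $(s,s')\in\mathcal{R}$ then $(t,t')\in\mathcal{S}$. Sets $L,R,J\subseteq(Ctrl\times Ctrl')\times(Sto\times Sto')$ are live if states in $L$ have a $\to$-successor on the left, states in $R$ a $\to'$-successor on the right, states in $J$ both. The alignment automaton $\prod(A,A',L,R,J)$ is $(Ctrl\times Ctrl',Sto\times Sto',(\mathit{init},\mathit{init}'),(\mathit{fin},\mathit{fin}'),\Rightarrow)$ with $((n,n'),(s,s'))\Rightarrow((m,m'),(t,t'))$ iff (LO) source in $L$, $(n,s)\to(m,t)$, $(n',s')=(m',t')$; or (RO) source in $R$, $(n,s)=(m,t)$, $(n',s')\to'(m',t')$; or (JO) source in $J$, $(n,s)\to(m,t)$, $(n',s')\to'(m',t')$. It is $\mathcal{Q}$-adequate if for all $(s,s')\in\mathcal{Q}$ and $t,t'$ with $(\mathit{init},s)\to^*(\mathit{fin},t)$ and $(\mathit{init}',s')\to'^*(\mathit{fin}',t')$ we have $((\mathit{init},\mathit{init}'),(s,s'))\Rightarrow^*((\mathit{fin},\mathit{fin}'),(t,t'))$. -}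

module Defs where

open import Level using (Level; _⊔_; suc)
open import Data.Nat using (ℕ; _*_)
open import Data.Fin using (Fin)
open import Data.Fin.Properties using (*↔×)
open import Data.Product using (Σ; ∃; _×_; _,_; proj₁; proj₂)
open import Data.Sum using (_⊎_)
open import Function.Bundles using (_↔_)
open import Function.Properties.Inverse using (↔-trans; ↔-sym)
open import Data.Product.Function.NonDependent.Propositional using (_×-↔_)
open import Relation.Binary.PropositionalEquality using (_≡_; _≢_; cong)
open import Relation.Nullary using (¬_)
open import Relation.Unary using (Pred; _∈_)
open import Relation.Binary.Construct.Closure.ReflexiveTransitive using (Star)

Finite : ∀ {a} → Set a → Set a
Finite C = Σ ℕ λ n → C ↔ Fin n

record Automaton (c s : Level) : Set (Level.suc (c ⊔ s)) where
  field
    Ctrl   : Set c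
    Sto    : Set s
    ctrlFinite : Finite Ctrl
    init   : Ctrl
    fin    : Ctrl
    init≢fin : init ≢ fin
    _⟶_   : Ctrl × Sto → Ctrl × Sto → Set (c ⊔ s)
    fin-stuck : ∀ {n s m t} → (n , s) ⟶ (m , t) → n ≢ fin
    ctrl-moves : ∀ {n s m t} → (n , s) ⟶ (m , t) → n ≢ m

  _⟶*_ : Ctrl × Sto → Ctrl × Sto → Set (c ⊔ s)
  _⟶*_ = Star _⟶_

open Automaton

record Annotation {c s} ℓ (B : Automaton c s) (P Q : Pred (Sto B) ℓ)
       : Set (c ⊔ s ⊔ Level.suc ℓ) where
  field
    an      : Ctrl B → Pred (Sto B) ℓ
    an-init : an (init B) ≡ P
    an-fin  : an (fin B) ≡ Q
open Annotation public

Valid : ∀ {c s ℓ} {B : Automaton c s} {P Q : Pred (Sto B) ℓ} →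
        Annotation ℓ B P Q → Set (c ⊔ s ⊔ ℓ)
Valid {B = B} a = ∀ (n m : Ctrl B) (s t : Sto B) →
  s ∈ an a n → _⟶_ B (n , s) (m , t) → t ∈ an a m

StoRel : ∀ {c s c' s'} ℓ → Automaton c s → Automaton c' s' → Set _
StoRel ℓ A A' = Pred (Sto A × Sto A') ℓ

_,_⊨⟨_⇒_⟩ : ∀ {c s c' s' ℓ} (A : Automaton c s) (A' : Automaton c' s') →
            StoRel ℓ A A' → StoRel ℓ A A' → Set _
A , A' ⊨⟨ ℛ ⇒ 𝒮 ⟩ = ∀ s s' t t' →
  _⟶*_ A (init A , s) (fin A , t) →
  _⟶*_ A' (init A' , s') (fin A' , t') →
  (s , s') ∈ ℛ → (t , t') ∈ 𝒮

AlignCond : ∀ {c s c' s'} ℓ → Automaton c s → Automaton c' s' → Set _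
AlignCond ℓ A A' = Pred ((Ctrl A × Ctrl A') × (Sto A × Sto A')) ℓ

Live : ∀ {c s c' s' ℓ} (A : Automaton c s) (A' : Automaton c' s') →
       (L R J : AlignCond ℓ A A') → Set _
Live A A' L R J =
  (∀ n n' s s' → ((n , n') , (s , s')) ∈ L →
     ∃ λ mt → _⟶_ A (n , s) mt)
  × (∀ n n' s s' → ((n , n') , (s , s')) ∈ R →
     ∃ λ mt' → _⟶_ A' (n' , s') mt')
  × (∀ n n' s s' → ((n , n') , (s , s')) ∈ J →
     (∃ λ mt → _⟶_ A (n , s) mt) × (∃ λ mt' → _⟶_ A' (n' , s') mt'))

data AlignStep {c s c' s' ℓ} (A : Automaton c s) (A' : Automaton c' s')
     (L R J : AlignCond ℓ A A') :
     (Ctrl A × Ctrl A') × (Sto A × Sto A') →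
     (Ctrl A × Ctrl A') × (Sto A × Sto A') → Set (c ⊔ s ⊔ c' ⊔ s' ⊔ ℓ) where
  LO : ∀ {n n' m s s' t} → ((n , n') , (s , s')) ∈ L →
       _⟶_ A (n , s) (m , t) →
       AlignStep A A' L R J ((n , n') , (s , s')) ((m , n') , (t , s'))
  RO : ∀ {n n' m' s s' t'} → ((n , n') , (s , s')) ∈ R →
       _⟶_ A' (n' , s') (m' , t') →
       AlignStep A A' L R J ((n , n') , (s , s')) ((n , m') , (s , t'))
  JO : ∀ {n n' m m' s s' t t'} → ((n , n') , (s , s')) ∈ J →
       _⟶_ A (n , s) (m , t) → _⟶_ A' (n' , s') (m' , t') →
       AlignStep A A' L R J ((n , n') , (s , s')) ((m , m') , (t , t'))

∏ : ∀ {c s c' s' ℓ} (A : Automaton c s) (A' : Automaton c' s') →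
    (L R J : AlignCond ℓ A A') → Automaton (c ⊔ c') (s ⊔ s' ⊔ c ⊔ c' ⊔ ℓ)
∏ {c} {s} {c'} {s'} {ℓ} A A' L R J = record
  { Ctrl = Ctrl A × Ctrl A'
  ; Sto = Level.Lift (c ⊔ c' ⊔ ℓ) (Sto A × Sto A')
  ; ctrlFinite = (proj₁ (ctrlFinite A) * proj₁ (ctrlFinite A'))
      , ↔-trans (proj₂ (ctrlFinite A) ×-↔ proj₂ (ctrlFinite A')) (↔-sym *↔×)
  ; init = (init A , init A')
  ; fin = (fin A , fin A')
  ; init≢fin = λ eq → init≢fin A (cong proj₁ eq)
  ; _⟶_ = λ { (nn , Level.lift ss) (mm , Level.lift tt) →
              AlignStep A A' L R J (nn , ss) (mm , tt) }
  ; fin-stuck = λ st eq → stuck st eq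
  ; ctrl-moves = λ st eq → moves st eq
  }
  where


  stuck : ∀ {nn ss mm tt} → AlignStep A A' L R J (nn , ss) (mm , tt) →
          nn ≢ (fin A , fin A')
  stuck (LO _ x) eq = fin-stuck A x (cong proj₁ eq)
  stuck (RO _ x) eq = fin-stuck A' x (cong proj₂ eq)
  stuck (JO _ x _) eq = fin-stuck A x (cong proj₁ eq)
  moves : ∀ {nn ss mm tt} → AlignStep A A' L R J (nn , ss) (mm , tt) → nn ≢ mm
  moves (LO _ x) eq = ctrl-moves A x (cong proj₁ eq)
  moves (RO _ x) eq = ctrl-moves A' x (cong proj₂ eq)
  moves (JO _ x _) eq = ctrl-moves A x (cong proj₁ eq)

Adequate : ∀ {c s c' s' ℓ} (A : Automaton c s) (A' : Automaton c' s') →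
           (L R J : AlignCond ℓ A A') → StoRel ℓ A A' → Set _
Adequate A A' L R J 𝒬 = ∀ s s' t t' → (s , s') ∈ 𝒬 →
  _⟶*_ A (init A , s) (fin A , t) →
  _⟶*_ A' (init A' , s') (fin A' , t') →
  Star (AlignStep A A' L R J) ((init A , init A') , (s , s'))
                              ((fin A , fin A') , (t , t'))

liftRel : ∀ {c s c' s' ℓ} (A : Automaton c s) (A' : Automaton c' s')
          (L R J : AlignCond ℓ A A') →
          StoRel ℓ A A' → Pred (Sto (∏ A A' L R J)) ℓ
liftRel A A' L R J ℛ (Level.lift ss) = ℛ ss

{-# OPTIONS --safe #-}
module Submission where

-- A valid annotation is an inductive invariant of the alignment automaton, so every
-- run of ∏(A, A', L, R, J) from a 𝒬-store ending at (fin, fin') ends in 𝒮. Adequacy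
-- turns any pair of terminating runs of A and A' from 𝒬-related stores into such a run.

open import Defs
open import Level using (lift)
open import Data.Product using (_,_)
open import Function using (id)
open import Relation.Binary.PropositionalEquality using (subst; sym)
open import Relation.Unary using (Pred; _∈_)
open import Relation.Binary.Construct.Closure.ReflexiveTransitive using (Star; ε; _◅_; gmap)
open Automaton

module _ {c s ℓ} {B : Automaton c s} {P Q : Pred (Sto B) ℓ}
         (a : Annotation ℓ B P Q) (valid : Valid a) where

  valid-preserved-by-runs : ∀ {n m s t} → _⟶*_ B (n , s) (m , t) → s ∈ an a n → t ∈ an a m
  valid-preserved-by-runs ε                        s∈an = s∈an
  valid-preserved-by-runs {n} {s = s} (_◅_ {j = k , u} step run) s∈an =
    valid-preserved-by-runs run (valid n k s u s∈an step)

  valid⇒partial-correct : ∀ {s t} → _⟶*_ B (init B , s) (fin B , t) → s ∈ P → t ∈ Q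
  valid⇒partial-correct {s} {t} run s∈P =
    subst (λ R → t ∈ R) (an-fin a)
      (valid-preserved-by-runs run (subst (λ R → s ∈ R) (sym (an-init a)) s∈P))

alignStep*⇒∏-run : ∀ {c s c' s' ℓ} {A : Automaton c s} {A' : Automaton c' s'}
  {L R J : AlignCond ℓ A A'} {nn mm ss tt} →
  Star (AlignStep A A' L R J) (nn , ss) (mm , tt) →
  _⟶*_ (∏ A A' L R J) (nn , lift ss) (mm , lift tt)
alignStep*⇒∏-run = gmap (λ { (nn , ss) → nn , lift ss }) id

corollary4p8 : ∀ {c s c' s' ℓ} (A : Automaton c s) (A' : Automaton c' s')
    (L R J : AlignCond ℓ A A') → Live A A' L R J →
    (𝒬 𝒮 : StoRel ℓ A A') →
    Adequate A A' L R J 𝒬 →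
    (a : Annotation ℓ (∏ A A' L R J) (liftRel A A' L R J 𝒬)
      (liftRel A A' L R J 𝒮)) →
    Valid a →
    A , A' ⊨⟨ 𝒬 ⇒ 𝒮 ⟩
corollary4p8 A A' L R J _ 𝒬 𝒮 adequate a valid s s' t t' run run' q =
  valid⇒partial-correct a valid (alignStep*⇒∏-run (adequate s s' t t' q run run')) q
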